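{- Let $m,n$ be positive integers and let $G=P_n^m$ or $G=C_n^m$ (vertex set $[n]$ with addition modulo $n$). Let $i\in[n]$ and $m+1\leq t\leq n$. Let $S$ be a legal dominating sequence of $G$ such that $I_S\cap[i,i+t]_n=\{i,i+t\}$. Then $|\widehat S\cap[i,i+t)_n|\leq t-m$.
   Context: $[n]=\{1,\dots,n\}$ with addition modulo $n$. For $a,b\in[n]$, let $t_0$ be the minimum non-negative integer with $a+t_0=b$; the circular interval is $[a,b]_n=\{a+s: 0\le s\le t_0\}$ and $[a,b)_n=[a,b]_n\setminus\{b\}$. $P_n$ has vertex set $[n]$ and edges $\{i,i+1\}$, $i\in[n-1]$; $C_n$ has vertex set $[n]$ and edges $\{i,i+1\}$, $i\in[n]$. For a connected graph $G$, $G^m$ has the same vertices and $uv$ is an edge iff the distance in $G$ between $u,v$ is at most $m$. For a sequence $S=(v_1,\dots,v_k)$ of distinct vertices, $\widehat S=\{v_1,\dots,v_k\}$, $PN_S(v_i)=N[v_i]\setminus\bigcup_{j<i}N[v_j]$; $S$ is legal dominating if $\widehat S$ dominates $G$ and each $PN_S(v_i)\ne\emptyset$. The footprinter $f_S(x)$ of a vertex $x$ is the unique $v_i$ with $x\in PN_S(v_i)$, and $I_S=\{x: f_S(x)=x\}$. -}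

module Defs where

open import Data.Nat using (ℕ; zero; suc; _+_; _∸_; _≤_; _<_)
open import Data.Nat.DivMod using (_%_)
open import Data.Fin using (Fin; toℕ)
open import Data.List using (List; length; lookup)
open import Data.List.Relation.Unary.All using (All)
open import Data.List.Relation.Unary.Unique.Propositional using (Unique)
open import Data.List.Membership.Propositional using (_∈_)
open import Data.Product using (Σ; _×_; ∃)
open import Data.Sum using (_⊎_)
open import Relation.Binary.PropositionalEquality using (_≡_; _≢_)
open import Relation.Nullary using (¬_)

InV : ℕ → ℕ → Set
InV n v = 1 ≤ v × v ≤ n

plusMod : ℕ → ℕ → ℕ → ℕ
plusMod zero    a s = a
plusMod (suc k) a s = suc ((a + s ∸ 1) % suc k)

data Kind : Set where
  path cycle : Kind

Edge : Kind → ℕ → ℕ → ℕ → Set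
Edge path  n u v = (1 ≤ u × u < n × v ≡ suc u) ⊎ (1 ≤ v × v < n × u ≡ suc v)
Edge cycle n u v = (InV n u × v ≡ plusMod n u 1) ⊎ (InV n v × u ≡ plusMod n v 1)

data Walk (E : ℕ → ℕ → Set) : ℕ → ℕ → ℕ → Set where
  here : ∀ {u} → Walk E 0 u u
  step : ∀ {k u w v} → E u w → Walk E k w v → Walk E (suc k) u v

-- Distance in G between u and v is at most m  (i.e. u = v or uv is an edge of G^m).
DistLe : Kind → ℕ → ℕ → ℕ → ℕ → Set
DistLe g n m u v = Σ ℕ λ k → k ≤ m × Walk (Edge g n) k u v

InN : Kind → ℕ → ℕ → ℕ → ℕ → Set
InN g n m v x = InV n x × DistLe g n m v x

InPN : Kind → ℕ → ℕ → (S : List ℕ) → Fin (length S) → ℕ → Set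
InPN g n m S i x =
  InN g n m (lookup S i) x × (∀ (j : Fin (length S)) → toℕ j < toℕ i → ¬ InN g n m (lookup S j) x)

LegalDom : Kind → ℕ → ℕ → List ℕ → Set
LegalDom g n m S =
  Unique S × All (InV n) S
  × (∀ x → InV n x → Σ (Fin (length S)) λ i → InN g n m (lookup S i) x)
  × (∀ (i : Fin (length S)) → ∃ λ x → InPN g n m S i x)

Footprint : Kind → ℕ → ℕ → List ℕ → ℕ → ℕ → Set
Footprint g n m S x v = Σ (Fin (length S)) λ i → lookup S i ≡ v × InPN g n m S i x

InI : Kind → ℕ → ℕ → List ℕ → ℕ → Set
InI g n m S x = Footprint g n m S x x

-- x ∈ [a,b]_n : x = a + s with 0 ≤ s ≤ t₀, where t₀ is the least r ≥ 0 with a + r = b;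
-- "s ≤ t₀" is expressed as: no r < s has a + r = b.
InCI : ℕ → ℕ → ℕ → ℕ → Set
InCI n a b x = Σ ℕ λ s → x ≡ plusMod n a s × (∀ r → r < s → plusMod n a r ≢ b)

InCIo : ℕ → ℕ → ℕ → ℕ → Set
InCIo n a b x = InCI n a b x × x ≢ b

-- |{x : P x}| ≤ k : every duplicate-free list of elements satisfying P has length ≤ k.
CardLe : (ℕ → Set) → ℕ → Set
CardLe P k = ∀ (L : List ℕ) → Unique L → All P L → length L ≤ k

-- Number the arc from i by positions 0, …, t. Among the vertices of Ŝ on the arc take the one
-- occurring last in S, say at position s, and a private neighbour p of it (for an endpoint, which
-- lies in I_S, the vertex itself). Every other vertex of Ŝ on the arc occurs earlier in S and so
-- does not dominate p; as p is within distance m of position s, some run of more than m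
-- consecutive positions holds at most one vertex of Ŝ. Counting gives |Ŝ ∩ [i, i+t]| ≤ t + 1 − m,
-- and i+t ∈ Ŝ lies outside [i, i+t). On the path an arc passing from n to 1 is cut there into two
-- runs, each treated alike.

module Submission where

open import Defs
open import Data.Nat using (ℕ; zero; suc; _+_; _∸_; _≤_; _<_; _≤?_; _<?_; z≤n; s≤s)
open import Data.Nat.Properties
open import Data.Nat.DivMod using (_%_; %-distribˡ-+; m%n%n≡m%n; m%n<n; m<n⇒m%n≡m; [m+n]%n≡m%n)
open import Data.Fin using (Fin; toℕ) renaming (zero to fzero; suc to fsuc)
open import Data.Fin.Properties using (toℕ-injective)
open import Data.List using (List; []; _∷_; length; lookup; filter; applyUpTo; _++_)
open import Data.List.Properties using (filter-notAll; length-applyUpTo; length-++)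
open import Data.List.Relation.Unary.All using (All; []; _∷_) renaming (map to all-map)
import Data.List.Relation.Unary.All as All
open import Data.List.Relation.Unary.All.Properties using (all-filter; filter⁺)
open import Data.List.Relation.Unary.Any using (Any; here; there; any?)
import Data.List.Relation.Unary.Any as Any
open import Data.List.Relation.Unary.Any.Properties using (lookup-index)
open import Data.List.Relation.Unary.AllPairs using (_∷_)
open import Data.List.Relation.Unary.Unique.Propositional using (Unique)
import Data.List.Relation.Unary.Unique.Propositional.Properties as Unique
open import Data.List.Membership.Propositional using (_∈_; lose)
open import Data.List.Membership.DecPropositional _≟_ using (_∈?_)
open import Data.List.Membership.Propositional.Properties
  using (∈-filter⁺; ∈-lookup; ∈-applyUpTo⁺; ∈-applyUpTo⁻; ∈-++⁺ˡ; ∈-++⁺ʳ)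
open import Data.Product using (Σ; _×_; _,_; proj₁; proj₂)
open import Data.Sum using (_⊎_; inj₁; inj₂; map₁)
open import Data.Empty using (⊥-elim)
open import Function using (_∘′_)
open import Relation.Nullary using (¬_; yes; no; ¬?)
open import Relation.Unary using (Decidable)
open import Relation.Binary using (tri<; tri≈; tri>)
open import Relation.Binary.Definitions using (DecidableEquality)
open import Relation.Binary.PropositionalEquality
  using (_≡_; _≢_; refl; sym; trans; cong; cong₂; subst; subst₂; module ≡-Reasoning)

module _ {A : Set} (_≟_ : DecidableEquality A) where

  unique-⊆-length : ∀ {xs ys : List A} → Unique xs → All (_∈ ys) xs → length xs ≤ length ys
  unique-⊆-length {[]} _ _ = z≤n
  unique-⊆-length {x ∷ xs} {ys} (x∉xs ∷ uxs) (x∈ys ∷ xs⊆ys) =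
    ≤-trans (s≤s (unique-⊆-length uxs (shrink x∉xs xs⊆ys))) (filter-notAll ≢x? ys (lose x∈ys λ x≢x → x≢x refl))
    where
    ≢x? : Decidable (λ y → ¬ y ≡ x)
    ≢x? y = ¬? (y ≟ x)
    shrink : ∀ {zs} → All (λ z → ¬ x ≡ z) zs → All (_∈ ys) zs → All (_∈ filter ≢x? ys) zs
    shrink [] [] = []
    shrink (x≢z ∷ x≢zs) (z∈ys ∷ zs⊆ys) =
      ∈-filter⁺ ≢x? z∈ys (λ z≡x → x≢z (sym z≡x)) ∷ shrink x≢zs zs⊆ys

  unique-lookup-injective : ∀ {xs : List A} → Unique xs → ∀ j k → lookup xs j ≡ lookup xs k → j ≡ k
  unique-lookup-injective {_ ∷ _} _ fzero fzero _ = refl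
  unique-lookup-injective {_ ∷ _} (x∉xs ∷ _) fzero (fsuc k) x≡ = ⊥-elim (All.lookup x∉xs (∈-lookup k) x≡)
  unique-lookup-injective {_ ∷ _} (x∉xs ∷ _) (fsuc j) fzero ≡x = ⊥-elim (All.lookup x∉xs (∈-lookup j) (sym ≡x))
  unique-lookup-injective {_ ∷ _} (_ ∷ uxs) (fsuc j) (fsuc k) e = cong fsuc (unique-lookup-injective uxs j k e)

module _ {A : Set} {P : A → Set} (P? : Decidable P) where

  length-filter-split : ∀ xs → length xs ≡ length (filter P? xs) + length (filter (λ x → ¬? (P? x)) xs)
  length-filter-split [] = refl
  length-filter-split (x ∷ xs) with P? x
  ... | yes _ = cong suc (length-filter-split xs)
  ... | no _ = trans (cong suc (length-filter-split xs)) (sym (+-suc _ _))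

  last-index : ∀ xs → Any P xs →
    Σ (Fin (length xs)) λ k → P (lookup xs k) × (∀ j → P (lookup xs j) → toℕ j ≤ toℕ k)
  last-index (x ∷ xs) pxs with any? P? xs
  ... | yes pxs′ with last-index xs pxs′
  ...   | k , pk , k-max = fsuc k , pk , λ { fzero _ → z≤n ; (fsuc j) pj → s≤s (k-max j pj) }
  last-index (x ∷ xs) (here px) | no ¬pxs =
    fzero , px , λ { fzero _ → z≤n ; (fsuc j) pj → ⊥-elim (¬pxs (lose (∈-lookup j) pj)) }
  last-index (x ∷ xs) (there pxs) | no ¬pxs = ⊥-elim (¬pxs pxs)

m∸n≤o⇒m≤o+n : ∀ m n {o} → m ∸ n ≤ o → m ≤ o + n
m∸n≤o⇒m≤o+n m n {o} m∸n≤o = ≤-trans (m≤n+m∸n m n) (≤-trans (+-monoʳ-≤ n m∸n≤o) (≤-reflexive (+-comm n o)))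

record Gap (m L s : ℕ) (Z : ℕ → Set) : Set where
  field
    start width : ℕ
    within : start + width ≤ suc L
    -- with `within`, L < width means the gap is the whole segment
    wide : m < width ⊎ L < width
    sparse : ∀ {r} → start ≤ r → r < start + width → Z r → r ≡ s

module _ {m L s : ℕ} {Z : ℕ → Set} where

  gap-ahead : ∀ {q} → s ≤ q → q ≤ s + m → q ≤ L →
    (∀ {r} → r ≤ L → q ≤ r + m → r ≤ q + m → Z r → r ≡ s) → Gap m L s Z
  gap-ahead {q} s≤q q≤s+m q≤L free with s + m ≤? L
  ... | yes s+m≤L = record
    { start = s ; width = suc m ; within = subst (_≤ suc L) (sym (+-suc s m)) (s≤s s+m≤L)
    ; wide = inj₁ ≤-refl ; sparse = sparse }
    where
    sparse : ∀ {r} → s ≤ r → r < s + suc m → Z r → r ≡ s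
    sparse {r} s≤r r<end = free (≤-trans r≤s+m s+m≤L) (≤-trans q≤s+m (+-monoˡ-≤ m s≤r))
                                (≤-trans r≤s+m (+-monoˡ-≤ m s≤q))
      where
      r≤s+m : r ≤ s + m
      r≤s+m = ≤-pred (subst (r <_) (+-suc s m) r<end)
  ... | no s+m≰L = record
    { start = q ∸ m ; width = suc L ∸ (q ∸ m) ; within = ≤-reflexive end≡ ; wide = wide ; sparse = sparse }
    where
    end≡ : q ∸ m + (suc L ∸ (q ∸ m)) ≡ suc L
    end≡ = m+[n∸m]≡n (≤-trans (m∸n≤m q m) (m≤n⇒m≤1+n q≤L))
    wide : m < suc L ∸ (q ∸ m) ⊎ L < suc L ∸ (q ∸ m)
    wide with m ≤? q
    ... | yes m≤q = inj₁ (m+n≤o⇒m≤o∸n (suc m) (s≤s (≤-trans (≤-reflexive (m+[n∸m]≡n m≤q)) q≤L)))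
    ... | no m≰q = inj₂ (subst (λ z → L < suc L ∸ z) (sym (m≤n⇒m∸n≡0 (<⇒≤ (≰⇒> m≰q)))) ≤-refl)
    sparse : ∀ {r} → q ∸ m ≤ r → r < q ∸ m + (suc L ∸ (q ∸ m)) → Z r → r ≡ s
    sparse {r} start≤r r<end = free r≤L q≤r+m (≤-trans r≤L (≤-trans (<⇒≤ (≰⇒> s+m≰L)) (+-monoˡ-≤ m s≤q)))
      where
      r≤L : r ≤ L
      r≤L = ≤-pred (subst (r <_) end≡ r<end)
      q≤r+m : q ≤ r + m
      q≤r+m = m∸n≤o⇒m≤o+n q m start≤r

  gap-behind : 0 < s → s ≤ L → Z 0 → (∀ {r} → r < s → s ≤ r + m → ¬ Z r) → Gap m L s Z
  gap-behind 0<s s≤L z0 free with m <? s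
  ... | no m≮s = ⊥-elim (free 0<s (≮⇒≥ m≮s) z0)
  ... | yes m<s = record
    { start = s ∸ m ; width = suc m ; within = ≤-trans (≤-reflexive end≡) (s≤s s≤L)
    ; wide = inj₁ ≤-refl ; sparse = sparse }
    where
    end≡ : s ∸ m + suc m ≡ suc s
    end≡ = trans (+-suc (s ∸ m) m) (cong suc (m∸n+n≡m (<⇒≤ m<s)))
    sparse : ∀ {r} → s ∸ m ≤ r → r < s ∸ m + suc m → Z r → r ≡ s
    sparse {r} start≤r r<end zr with r <? s
    ... | yes r<s = ⊥-elim (free r<s (m∸n≤o⇒m≤o+n s m start≤r) zr)
    ... | no r≮s = ≤-antisym (≤-pred (subst (r <_) end≡ r<end)) (≮⇒≥ r≮s)

CountBound : ℕ → ℕ → ℕ → Set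
CountBound m L a = a + m ≤ suc L ⊎ a ≤ 1

module _ {V : Set} (_≟_ : DecidableEquality V) {A : V → Set} (φ : ℕ → V) {m L s : ℕ} where

  gap-count : Gap m L s (λ r → A (φ r)) → ∀ {xs} → Unique xs →
    All (λ x → A x × x ∈ applyUpTo φ (suc L)) xs → CountBound m L (length xs)
  gap-count gap {xs} uxs xs⊆ = bound wide
    where
    open Gap gap
    rest : ℕ
    rest = suc L ∸ (start + width)
    later : ℕ → V
    later j = φ (start + width + j)
    candidates : List V
    candidates = φ s ∷ (applyUpTo φ start ++ applyUpTo later rest)
    candidate : ∀ {x} → A x × x ∈ applyUpTo φ (suc L) → x ∈ candidates
    candidate (ax , x∈seg) with ∈-applyUpTo⁻ φ x∈seg
    ... | r , r<sucL , refl with r <? start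
    ...   | yes r<start = there (∈-++⁺ˡ (∈-applyUpTo⁺ φ r<start))
    ...   | no r≮start with r <? start + width
    ...     | yes r<end = here (cong φ (sparse (≮⇒≥ r≮start) r<end ax))
    ...     | no r≮end = there (∈-++⁺ʳ (applyUpTo φ start) (subst (_∈ applyUpTo later rest)
                                          (cong φ (m+[n∸m]≡n (≮⇒≥ r≮end)))
                                          (∈-applyUpTo⁺ later (∸-monoˡ-< r<sucL (≮⇒≥ r≮end)))))
    length-candidates : length candidates + width ≡ suc (suc L)
    length-candidates = begin
      suc (length (applyUpTo φ start ++ applyUpTo later rest)) + width
        ≡⟨ cong (λ z → suc z + width) (trans (length-++ (applyUpTo φ start))
                                             (cong₂ _+_ (length-applyUpTo φ start) (length-applyUpTo later rest))) ⟩
      suc (start + rest + width)   ≡⟨ cong suc (trans (+-assoc start rest width) (cong (start +_) (+-comm rest width))) ⟩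
      suc (start + (width + rest)) ≡⟨ cong suc (trans (sym (+-assoc start width rest)) (m+[n∸m]≡n within)) ⟩
      suc (suc L) ∎
      where open ≡-Reasoning
    total : length xs + width ≤ suc (suc L)
    total = ≤-trans (+-monoˡ-≤ width (unique-⊆-length _≟_ uxs (all-map candidate xs⊆))) (≤-reflexive length-candidates)
    bound : m < width ⊎ L < width → CountBound m L (length xs)
    bound (inj₁ m<width) = inj₁ (≤-pred (≤-trans (≤-reflexive (sym (+-suc (length xs) m)))
                                                 (≤-trans (+-monoʳ-≤ (length xs) m<width) total)))
    bound (inj₂ L<width) = inj₂ (+-cancelʳ-≤ (suc L) (length xs) 1 (≤-trans (+-monoʳ-≤ (length xs) L<width) total))

module Chart (g : Kind) (n m : ℕ) (φ : ℕ → ℕ) (L : ℕ) where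

  Near : Set
  Near = ∀ {r r′} → r ≤ L → r′ ≤ L → r ≤ r′ + m → r′ ≤ r + m → InN g n m (φ r) (φ r′)

  -- p behaves like the vertex at a virtual position q ∈ [s, s + m], possibly beyond L
  Ahead : ℕ → ℕ → ℕ → Set
  Ahead s q p = s ≤ q × q ≤ s + m × (∀ {r} → r ≤ L → q ≤ r + m → r ≤ q + m → InN g n m (φ r) p)

  -- p lies before position s, possibly before position 0
  Behind : ℕ → ℕ → Set
  Behind s p = ∀ {r} → r < s → s ≤ r + m → InN g n m (φ r) p

  SomeAhead AheadWithin : ℕ → ℕ → Set
  SomeAhead s p = Σ ℕ λ q → Ahead s q p
  AheadWithin s p = Σ ℕ λ q → q ≤ L × Ahead s q p

  Classification : (ℕ → ℕ → Set) → Set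
  Classification Forward = ∀ {s p} → s ≤ L → InN g n m (φ s) p → Forward s p ⊎ Behind s p

SegmentBound : ℕ → List ℕ → (ℕ → ℕ) → ℕ → Set
SegmentBound m S φ L =
  ∀ {xs} → Unique xs → All (λ x → x ∈ S × x ∈ applyUpTo φ (suc L)) xs → CountBound m L (length xs)

module _ {g : Kind} {n m : ℕ} {S : List ℕ} where

  I⇒∈ : ∀ {x} → InI g n m S x → x ∈ S
  I⇒∈ (k , refl , _) = ∈-lookup k

  I⇒PN : Unique S → ∀ {x k} → lookup S k ≡ x → InI g n m S x → InPN g n m S k x
  I⇒PN uS {k = k} ≡x (j , ≡x′ , pn) =
    subst (λ k → InPN g n m S k _) (unique-lookup-injective _≟_ uS j k (trans ≡x′ (sym ≡x))) pn

module Segment {g : Kind} {n m : ℕ} {S : List ℕ} (legal : LegalDom g n m S)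
  (φ : ℕ → ℕ) (L : ℕ)
  (injective : ∀ {r r′} → r ≤ L → r′ ≤ L → φ r ≡ φ r′ → r ≡ r′)
  (near : Chart.Near g n m φ L)
  (first : InI g n m S (φ 0)) where

  open Chart g n m φ L

  record LastInSegment : Set where
    field
      pos : ℕ
      pos≤L : pos ≤ L
      index : Fin (length S)
      lookup≡ : lookup S index ≡ φ pos
      undominated : ∀ {p r} → InPN g n m S index p → r ≤ L → φ r ∈ S → InN g n m (φ r) p → r ≡ pos

  last-in-segment : LastInSegment
  last-in-segment with last-index (_∈? applyUpTo φ (suc L)) S (lose (I⇒∈ first) (∈-applyUpTo⁺ φ (s≤s z≤n)))
  ... | k , k∈seg , k-last with ∈-applyUpTo⁻ φ k∈seg
  ...   | s , s<sucL , lookup≡ = record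
    { pos = s ; pos≤L = ≤-pred s<sucL ; index = k ; lookup≡ = lookup≡ ; undominated = undominated }
    where
    undominated : ∀ {p r} → InPN g n m S k p → r ≤ L → φ r ∈ S → InN g n m (φ r) p → r ≡ s
    undominated {p} {r} (_ , earlier-miss) r≤L φr∈S dom with r ≟ s
    ... | yes r≡s = r≡s
    ... | no r≢s = ⊥-elim (earlier-miss j (≤∧≢⇒< j≤k j≢k) (subst (λ v → InN g n m v p) (lookup-index φr∈S) dom))
      where
      j : Fin (length S)
      j = Any.index φr∈S
      j≤k : toℕ j ≤ toℕ k
      j≤k = k-last j (subst (_∈ applyUpTo φ (suc L)) (lookup-index φr∈S) (∈-applyUpTo⁺ φ (s≤s r≤L)))
      j≢k : toℕ j ≢ toℕ k
      j≢k j≡k = r≢s (injective r≤L (≤-pred s<sucL)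
        (trans (lookup-index φr∈S) (trans (cong (lookup S) (toℕ-injective j≡k)) lookup≡)))

  Shape : ℕ → ℕ → Set
  Shape s p = AheadWithin s p ⊎ (0 < s × Behind s p)

  Witness : LastInSegment → Set
  Witness ℓ = Σ ℕ λ p → InPN g n m S (LastInSegment.index ℓ) p × Shape (LastInSegment.pos ℓ) p

  module _ (ℓ : LastInSegment) where
    open LastInSegment ℓ

    witness-gap : Witness ℓ → Gap m L pos (λ r → φ r ∈ S)
    witness-gap (p , pn , inj₁ (q , q≤L , s≤q , q≤s+m , dom)) =
      gap-ahead s≤q q≤s+m q≤L λ r≤L q≤r+m r≤q+m φr∈S → undominated pn r≤L φr∈S (dom r≤L q≤r+m r≤q+m)
    witness-gap (p , pn , inj₂ (0<s , dom)) =
      gap-behind 0<s pos≤L (I⇒∈ first) λ r<s s≤r+m φr∈S →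
        <⇒≢ r<s (undominated pn (≤-trans (<⇒≤ r<s) pos≤L) φr∈S (dom r<s s≤r+m))

    self-witness : InI g n m S (φ pos) → Witness ℓ
    self-witness I = φ pos , I⇒PN (proj₁ legal) lookup≡ I ,
      inj₁ (pos , pos≤L , ≤-refl , m≤m+n pos m , λ r≤L pos≤r+m r≤pos+m → near r≤L pos≤L r≤pos+m pos≤r+m)

    PrivateNeighbour : Set
    PrivateNeighbour = Σ ℕ λ p → InPN g n m S index p × InN g n m (φ pos) p

    private-neighbour : PrivateNeighbour
    private-neighbour with proj₂ (proj₂ (proj₂ legal)) index
    ... | p , pn = p , pn , subst (λ v → InN g n m v p) lookup≡ (proj₁ pn)

    open-witness : Classification AheadWithin → Witness ℓ
    open-witness classify with pos ≟ 0 | private-neighbour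
    ... | yes refl | _ = self-witness first
    ... | no pos≢0 | p , pn , dom with classify pos≤L dom
    ...   | inj₁ ahead = p , pn , inj₁ ahead
    ...   | inj₂ behind = p , pn , inj₂ (n≢0⇒n>0 pos≢0 , behind)

    closed-witness : InI g n m S (φ L) → Classification SomeAhead → Witness ℓ
    closed-witness final classify with pos ≟ 0 | pos ≟ L | private-neighbour
    ... | yes refl | _ | _ = self-witness first
    ... | no _ | yes refl | _ = self-witness final
    ... | no pos≢0 | no pos≢L | p , pn , dom with classify pos≤L dom
    ...   | inj₂ behind = p , pn , inj₂ (n≢0⇒n>0 pos≢0 , behind)
    ...   | inj₁ (q , s≤q , q≤s+m , dom-q) with q ≤? L
    ...     | yes q≤L = p , pn , inj₁ (q , q≤L , s≤q , q≤s+m , dom-q)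
    -- otherwise φ L, which occurs earlier in S than φ pos, would dominate p
    ...     | no q≰L = ⊥-elim (pos≢L (sym (undominated pn ≤-refl (I⇒∈ final)
                  (dom-q ≤-refl (≤-trans q≤s+m (+-monoˡ-≤ m pos≤L)) (≤-trans (<⇒≤ (≰⇒> q≰L)) (m≤m+n q m))))))

  open-bound : Classification AheadWithin → SegmentBound m S φ L
  open-bound classify = gap-count _≟_ φ (witness-gap ℓ (open-witness ℓ classify))
    where
    ℓ : LastInSegment
    ℓ = last-in-segment

  closed-bound : InI g n m S (φ L) → Classification SomeAhead → SegmentBound m S φ L
  closed-bound final classify = gap-count _≟_ φ (witness-gap ℓ (closed-witness ℓ final classify))
    where
    ℓ : LastInSegment
    ℓ = last-in-segment

module Cyclic (k : ℕ) where

  open ≡-Reasoning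

  N : ℕ
  N = suc k

  infixl 6 _⊕_
  _⊕_ : ℕ → ℕ → ℕ
  a ⊕ s = plusMod N a s

  ⊕-assoc : ∀ {a} → 1 ≤ a → ∀ x y → a ⊕ x ⊕ y ≡ a ⊕ (x + y)
  ⊕-assoc {suc a} _ x y = cong suc (begin
    ((a + x) % N + y) % N            ≡⟨ %-distribˡ-+ ((a + x) % N) y N ⟩
    ((a + x) % N % N + y % N) % N    ≡⟨ cong (λ z → (z + y % N) % N) (m%n%n≡m%n (a + x) N) ⟩
    ((a + x) % N + y % N) % N        ≡⟨ sym (%-distribˡ-+ (a + x) y N) ⟩
    (a + x + y) % N                  ≡⟨ cong (_% N) (+-assoc a x y) ⟩
    (a + (x + y)) % N                ∎)

  ⊕-vertex : ∀ a s → InV N (a ⊕ s)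
  ⊕-vertex a s = s≤s z≤n , s≤s (≤-pred (m%n<n (a + s ∸ 1) N))

  ⊕-identityʳ : ∀ {a} → InV N a → a ⊕ 0 ≡ a
  ⊕-identityʳ {suc a} (_ , a<N) = cong suc (trans (cong (_% N) (+-identityʳ a)) (m<n⇒m%n≡m a<N))

  ⊕-period : ∀ {a} → InV N a → a ⊕ N ≡ a
  ⊕-period {suc a} (_ , a<N) = cong suc (trans ([m+n]%n≡m%n a N) (m<n⇒m%n≡m a<N))

  ⊕-no-wrap : ∀ {a} s → 1 ≤ a → a + s ≤ N → a ⊕ s ≡ a + s
  ⊕-no-wrap {suc a} s _ a+s<N = cong suc (m<n⇒m%n≡m a+s<N)

  ⊕-wrap : ∀ {a} s → 1 ≤ a → N < a + s → a + s ≤ N + N → a ⊕ s ≡ a + s ∸ N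
  ⊕-wrap {suc a} s _ (s≤s N≤a+s) (s≤s a+s≤k+N) = begin
    suc ((a + s) % N)               ≡⟨ cong (λ z → suc (z % N)) (sym (m∸n+n≡m N≤a+s)) ⟩
    suc ((a + s ∸ N + N) % N)       ≡⟨ cong suc ([m+n]%n≡m%n (a + s ∸ N) N) ⟩
    suc ((a + s ∸ N) % N)           ≡⟨ cong suc (m<n⇒m%n≡m reduced<N) ⟩
    suc (a + s ∸ N)                 ≡⟨ sym (+-∸-assoc 1 N≤a+s) ⟩
    suc a + s ∸ N                   ∎
    where
    reduced<N : a + s ∸ N < N
    reduced<N = ≤-<-trans (∸-monoˡ-≤ N a+s≤k+N) (≤-<-trans (≤-reflexive (m+n∸n≡m k N)) (n<1+n k))

  ⊕-succ-cancel : ∀ {x y} → InV N x → InV N y → x ⊕ 1 ≡ y ⊕ 1 → x ≡ y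
  ⊕-succ-cancel {x} {y} vx vy eq = begin
    x             ≡⟨ sym (⊕-period vx) ⟩
    x ⊕ (1 + k)   ≡⟨ sym (⊕-assoc (proj₁ vx) 1 k) ⟩
    x ⊕ 1 ⊕ k     ≡⟨ cong (_⊕ k) eq ⟩
    y ⊕ 1 ⊕ k     ≡⟨ ⊕-assoc (proj₁ vy) 1 k ⟩
    y ⊕ (1 + k)   ≡⟨ ⊕-period vy ⟩
    y             ∎

  ⊕-cancelʳ : ∀ c {x y} → InV N x → InV N y → x ⊕ c ≡ y ⊕ c → x ≡ y
  ⊕-cancelʳ zero vx vy eq = trans (sym (⊕-identityʳ vx)) (trans eq (⊕-identityʳ vy))
  ⊕-cancelʳ (suc c) {x} {y} vx vy eq = ⊕-cancelʳ c vx vy (⊕-succ-cancel (⊕-vertex x c) (⊕-vertex y c) (begin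
    x ⊕ c ⊕ 1   ≡⟨ ⊕-assoc (proj₁ vx) c 1 ⟩
    x ⊕ (c + 1) ≡⟨ cong (x ⊕_) (+-comm c 1) ⟩
    x ⊕ suc c   ≡⟨ eq ⟩
    y ⊕ suc c   ≡⟨ cong (y ⊕_) (+-comm 1 c) ⟩
    y ⊕ (c + 1) ≡⟨ sym (⊕-assoc (proj₁ vy) c 1) ⟩
    y ⊕ c ⊕ 1   ∎))

  ⊕-swap : ∀ {a} → 1 ≤ a → ∀ x y → a ⊕ x ⊕ y ≡ a ⊕ y ⊕ x
  ⊕-swap {a} 1≤a x y = trans (⊕-assoc 1≤a x y) (trans (cong (a ⊕_) (+-comm x y)) (sym (⊕-assoc 1≤a y x)))

  ⊕-no-fixpoint : ∀ {y c} → InV N y → 0 < c → c < N → y ⊕ c ≢ y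
  ⊕-no-fixpoint {y} {c} (1≤y , y≤N) 0<c c<N eq with y + c ≤? N
  ... | yes y+c≤N =
    <⇒≢ 0<c (sym (+-cancelˡ-≡ y c 0 (trans (trans (sym (⊕-no-wrap c 1≤y y+c≤N)) eq) (sym (+-identityʳ y)))))
  ... | no y+c≰N = <⇒≢ c<N (+-cancelˡ-≡ y c N (trans (sym (m∸n+n≡m (<⇒≤ N<y+c)))
                     (cong (_+ N) (trans (sym (⊕-wrap c 1≤y N<y+c (+-mono-≤ y≤N (<⇒≤ c<N)))) eq))))
    where
    N<y+c : N < y + c
    N<y+c = ≰⇒> y+c≰N

  ⊕-shift-distinct : ∀ {i} → InV N i → ∀ {a b} → a < b → b < N → i ⊕ a ≢ i ⊕ b
  ⊕-shift-distinct {i} vi {a} {b} a<b b<N eq with m≤n⇒∃[o]m+o≡n a<b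
  ... | c , refl = ⊕-no-fixpoint (⊕-vertex i a) (s≤s z≤n) (≤-<-trans (s≤s (m≤n+m c a)) b<N) (begin
    i ⊕ a ⊕ suc c     ≡⟨ ⊕-assoc (proj₁ vi) a (suc c) ⟩
    i ⊕ (a + suc c)   ≡⟨ cong (i ⊕_) (+-suc a c) ⟩
    i ⊕ suc (a + c)   ≡⟨ sym eq ⟩
    i ⊕ a             ∎)

  ⊕-injectiveʳ : ∀ {i} → InV N i → ∀ {a b} → a < N → b < N → i ⊕ a ≡ i ⊕ b → a ≡ b
  ⊕-injectiveʳ vi {a} {b} a<N b<N eq with <-cmp a b
  ... | tri≈ _ a≡b _ = a≡b
  ... | tri< a<b _ _ = ⊥-elim (⊕-shift-distinct vi a<b b<N eq)
  ... | tri> _ _ b<a = ⊥-elim (⊕-shift-distinct vi b<a a<N (sym eq))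

  CycleStep : ℕ → ℕ → Set
  CycleStep = Edge cycle N

  walk-forward : ∀ {x} → InV N x → ∀ j → Walk CycleStep j x (x ⊕ j)
  walk-forward vx zero = subst (Walk CycleStep 0 _) (sym (⊕-identityʳ vx)) here
  walk-forward {x} vx (suc j) = step (inj₁ (vx , refl))
    (subst (Walk CycleStep j (x ⊕ 1)) (⊕-assoc (proj₁ vx) 1 j) (walk-forward (⊕-vertex x 1) j))

  walk-backward : ∀ {x} → InV N x → ∀ j → Walk CycleStep j (x ⊕ j) x
  walk-backward {x} vx zero = subst (λ u → Walk CycleStep 0 u x) (sym (⊕-identityʳ vx)) here
  walk-backward {x} vx (suc j) = subst (λ u → Walk CycleStep (suc j) u x)
    (trans (⊕-assoc (proj₁ vx) j 1) (cong (x ⊕_) (+-comm j 1)))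
    (step (inj₂ (⊕-vertex x j , refl)) (walk-backward vx j))

  cycle-near : ∀ {m x y} a b → InV N x → InV N y → x ⊕ a ≡ y ⊕ b → a ≤ b + m → b ≤ a + m → InN cycle N m y x
  cycle-near {m} {x} {y} a b vx vy eq a≤b+m b≤a+m with b ≤? a
  ... | yes b≤a with m≤n⇒∃[o]m+o≡n b≤a
  ...   | c , refl = vx , c , +-cancelˡ-≤ b c m a≤b+m , subst (λ u → Walk CycleStep c u x) x⊕c≡y (walk-backward vx c)
    where
    x⊕c≡y : x ⊕ c ≡ y
    x⊕c≡y = ⊕-cancelʳ b (⊕-vertex x c) vy (trans (⊕-swap (proj₁ vx) c b) (trans (⊕-assoc (proj₁ vx) b c) eq))
  cycle-near {m} {x} {y} a b vx vy eq a≤b+m b≤a+m | no b≰a with m≤n⇒∃[o]m+o≡n (<⇒≤ (≰⇒> b≰a))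
  ...   | c , refl = vx , c , +-cancelˡ-≤ a c m b≤a+m , subst (Walk CycleStep c y) y⊕c≡x (walk-forward vy c)
    where
    y⊕c≡x : y ⊕ c ≡ x
    y⊕c≡x = ⊕-cancelʳ a (⊕-vertex y c) vx (trans (⊕-swap (proj₁ vy) c a) (trans (⊕-assoc (proj₁ vy) a c) (sym eq)))

  cycle-walk-offset : ∀ {j u v} → Walk CycleStep j u v → InV N v →
    Σ ℕ λ d → d ≤ j × (u ⊕ d ≡ v ⊎ v ⊕ d ≡ u)
  cycle-walk-offset here vv = 0 , z≤n , inj₁ (⊕-identityʳ vv)
  cycle-walk-offset {u = u} {v} (step (inj₁ (vu , refl)) w) vv with cycle-walk-offset w vv
  ... | d , d≤j , inj₁ fwd = suc d , s≤s d≤j , inj₁ (trans (sym (⊕-assoc (proj₁ vu) 1 d)) fwd)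
  ... | zero , _ , inj₂ bwd = 1 , s≤s z≤n , inj₁ (trans (sym bwd) (⊕-identityʳ vv))
  ... | suc d , d<j , inj₂ bwd = d , m≤n⇒m≤1+n (<⇒≤ d<j) , inj₂ (⊕-succ-cancel (⊕-vertex v d) vu
         (trans (⊕-assoc (proj₁ vv) d 1) (trans (cong (v ⊕_) (+-comm d 1)) bwd)))
  cycle-walk-offset {u = u} {v} (step {w = w} (inj₂ (vw , refl)) walk) vv with cycle-walk-offset walk vv
  ... | zero , _ , inj₁ fwd = 1 , s≤s z≤n , inj₂ (cong (_⊕ 1) (trans (sym fwd) (⊕-identityʳ vw)))
  ... | suc d , d<j , inj₁ fwd = d , m≤n⇒m≤1+n (<⇒≤ d<j) , inj₁ (trans (⊕-assoc (proj₁ vw) 1 d) fwd)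
  ... | d , d≤j , inj₂ bwd = suc d , s≤s d≤j ,
         inj₂ (trans (trans (sym (cong (v ⊕_) (+-comm d 1))) (sym (⊕-assoc (proj₁ vv) d 1))) (cong (_⊕ 1) bwd))

  module Rotation (m : ℕ) {i : ℕ} (vi : InV N i) (L : ℕ) where
    open Chart cycle N m (i ⊕_) L

    near : Near
    near {r} {r′} _ _ r≤r′+m r′≤r+m =
      cycle-near r r′ (⊕-vertex i r′) (⊕-vertex i r) (⊕-swap (proj₁ vi) r′ r) r≤r′+m r′≤r+m

    classify : ∀ {s p} → InN cycle N m (i ⊕ s) p → SomeAhead s p ⊎ Behind s p
    classify {s} {p} (vp , d₀ , d₀≤m , walk) with cycle-walk-offset walk vp
    ... | d , d≤d₀ , inj₁ i⊕s⊕d≡p = inj₁ (s + d , m≤m+n s d , +-monoʳ-≤ s (≤-trans d≤d₀ d₀≤m) , dom)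
      where
      dom : ∀ {r} → r ≤ L → s + d ≤ r + m → r ≤ s + d + m → InN cycle N m (i ⊕ r) p
      dom {r} _ q≤r+m r≤q+m = cycle-near r (s + d) vp (⊕-vertex i r) (begin
        p ⊕ r           ≡⟨ cong (_⊕ r) (sym i⊕s⊕d≡p) ⟩
        i ⊕ s ⊕ d ⊕ r   ≡⟨ cong (_⊕ r) (⊕-assoc (proj₁ vi) s d) ⟩
        i ⊕ (s + d) ⊕ r ≡⟨ ⊕-swap (proj₁ vi) (s + d) r ⟩
        i ⊕ r ⊕ (s + d) ∎) r≤q+m q≤r+m
    ... | d , d≤d₀ , inj₂ p⊕d≡i⊕s = inj₂ dom
      where
      dom : ∀ {r} → r < s → s ≤ r + m → InN cycle N m (i ⊕ r) p
      dom {r} r<s s≤r+m = cycle-near (d + r) s vp (⊕-vertex i r) (begin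
        p ⊕ (d + r)   ≡⟨ sym (⊕-assoc (proj₁ vp) d r) ⟩
        p ⊕ d ⊕ r     ≡⟨ cong (_⊕ r) p⊕d≡i⊕s ⟩
        i ⊕ s ⊕ r     ≡⟨ ⊕-swap (proj₁ vi) s r ⟩
        i ⊕ r ⊕ s     ∎)
        (≤-trans (+-mono-≤ (≤-trans d≤d₀ d₀≤m) (<⇒≤ r<s)) (≤-reflexive (+-comm m s)))
        (≤-trans s≤r+m (+-monoˡ-≤ m (m≤n+m r d)))

module Path (n : ℕ) where

  PathStep : ℕ → ℕ → Set
  PathStep = Edge path n

  walk-up : ∀ {u} → 1 ≤ u → ∀ j → u + j ≤ n → Walk PathStep j u (u + j)
  walk-up {u} _ zero _ = subst (Walk PathStep 0 u) (sym (+-identityʳ u)) here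
  walk-up {u} 1≤u (suc j) u+j<n = step (inj₁ (1≤u , ≤-trans (s≤s (m≤m+n u j)) u+j<n′ , refl))
    (subst (Walk PathStep j (suc u)) (sym (+-suc u j)) (walk-up (s≤s z≤n) j u+j<n′))
    where
    u+j<n′ : suc u + j ≤ n
    u+j<n′ = subst (_≤ n) (+-suc u j) u+j<n

  walk-down : ∀ {u} → 1 ≤ u → ∀ j → u + j ≤ n → Walk PathStep j (u + j) u
  walk-down {u} _ zero _ = subst (λ v → Walk PathStep 0 v u) (sym (+-identityʳ u)) here
  walk-down {u} 1≤u (suc j) u+j<n = step (inj₂ (≤-trans 1≤u (m≤m+n u j) , subst (_≤ n) (+-suc u j) u+j<n , +-suc u j))
    (walk-down 1≤u j (≤-trans (+-monoʳ-≤ u (n≤1+n j)) u+j<n))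

  path-near : ∀ {m x y} a b → InV n x → InV n y → x + a ≡ y + b → a ≤ b + m → b ≤ a + m → InN path n m y x
  path-near {m} {x} {y} a b vx vy eq a≤b+m b≤a+m with b ≤? a
  ... | yes b≤a with m≤n⇒∃[o]m+o≡n b≤a
  ...   | c , refl = vx , c , +-cancelˡ-≤ b c m a≤b+m ,
          subst (λ u → Walk PathStep c u x) x+c≡y (walk-down (proj₁ vx) c (subst (_≤ n) (sym x+c≡y) (proj₂ vy)))
    where
    x+c≡y : x + c ≡ y
    x+c≡y = +-cancelʳ-≡ b (x + c) y (trans (+-assoc x c b) (trans (cong (x +_) (+-comm c b)) eq))
  path-near {m} {x} {y} a b vx vy eq a≤b+m b≤a+m | no b≰a with m≤n⇒∃[o]m+o≡n (<⇒≤ (≰⇒> b≰a))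
  ...   | c , refl = vx , c , +-cancelˡ-≤ a c m b≤a+m ,
          subst (Walk PathStep c y) y+c≡x (walk-up (proj₁ vy) c (subst (_≤ n) (sym y+c≡x) (proj₂ vx)))
    where
    y+c≡x : y + c ≡ x
    y+c≡x = +-cancelʳ-≡ a (y + c) x (trans (+-assoc y c a) (trans (cong (y +_) (+-comm c a)) (sym eq)))

  path-walk-bound : ∀ {j u v} → Walk PathStep j u v → v ≤ u + j × u ≤ v + j
  path-walk-bound {u = u} here = m≤m+n u 0 , m≤m+n u 0
  path-walk-bound {suc j} {u} {v} (step (inj₁ (_ , _ , refl)) walk) with path-walk-bound walk
  ... | v≤ , u+1≤ = subst (v ≤_) (sym (+-suc u j)) v≤ , ≤-trans (n≤1+n u) (≤-trans u+1≤ (+-monoʳ-≤ v (n≤1+n j)))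
  path-walk-bound {suc j} {u} {v} (step {w = w} (inj₂ (_ , _ , refl)) walk) with path-walk-bound walk
  ... | v≤ , w≤ = ≤-trans v≤ (+-mono-≤ (n≤1+n w) (n≤1+n j)) , subst (suc w ≤_) (sym (+-suc v j)) (s≤s w≤)

  module Ascending (m : ℕ) {i L : ℕ} (1≤i : 1 ≤ i) (i+L≤n : i + L ≤ n) where
    open Chart path n m (i +_) L

    vertex : ∀ {r} → r ≤ L → InV n (i + r)
    vertex r≤L = ≤-trans 1≤i (m≤m+n _ _) , ≤-trans (+-monoʳ-≤ i r≤L) i+L≤n

    near : Near
    near {r} {r′} r≤L r′≤L = path-near r r′ (vertex r′≤L) (vertex r≤L)
      (trans (+-assoc i r′ r) (trans (cong (i +_) (+-comm r′ r)) (sym (+-assoc i r r′))))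

    classify : ∀ {s p} → s ≤ L → InN path n m (i + s) p → (Σ ℕ λ q → i + q ≤ n × Ahead s q p) ⊎ Behind s p
    classify {s} {p} s≤L (vp , d , d≤m , walk) with path-walk-bound walk | i + s ≤? p
    ... | p≤ , _ | yes i+s≤p with m≤n⇒∃[o]m+o≡n i+s≤p
    ...   | c , refl = inj₁ (s + c , subst (_≤ n) (+-assoc i s c) (proj₂ vp) , m≤m+n s c ,
                             +-monoʳ-≤ s (≤-trans (+-cancelˡ-≤ (i + s) c d p≤) d≤m) , dom)
      where
      dom : ∀ {r} → r ≤ L → s + c ≤ r + m → r ≤ s + c + m → InN path n m (i + r) (i + s + c)
      dom {r} r≤L q≤r+m r≤q+m = path-near r (s + c) vp (vertex r≤L) (begin
        i + s + c + r     ≡⟨ cong (_+ r) (+-assoc i s c) ⟩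
        i + (s + c) + r   ≡⟨ +-assoc i (s + c) r ⟩
        i + (s + c + r)   ≡⟨ cong (i +_) (+-comm (s + c) r) ⟩
        i + (r + (s + c)) ≡⟨ sym (+-assoc i r (s + c)) ⟩
        i + r + (s + c)   ∎) r≤q+m q≤r+m
        where open ≡-Reasoning
    classify {s} {p} s≤L (vp , d , d≤m , walk) | _ , i+s≤ | no i+s≰p with m≤n⇒∃[o]m+o≡n (<⇒≤ (≰⇒> i+s≰p))
    ...   | c , p+c≡i+s = inj₂ dom
      where
      c≤m : c ≤ m
      c≤m = ≤-trans (+-cancelˡ-≤ p c d (subst (_≤ p + d) (sym p+c≡i+s) i+s≤)) d≤m
      dom : ∀ {r} → r < s → s ≤ r + m → InN path n m (i + r) p
      dom {r} r<s s≤r+m = path-near (c + r) s vp (vertex (≤-trans (<⇒≤ r<s) s≤L)) (begin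
        p + (c + r)   ≡⟨ sym (+-assoc p c r) ⟩
        p + c + r     ≡⟨ cong (_+ r) p+c≡i+s ⟩
        i + s + r     ≡⟨ +-assoc i s r ⟩
        i + (s + r)   ≡⟨ cong (i +_) (+-comm s r) ⟩
        i + (r + s)   ≡⟨ sym (+-assoc i r s) ⟩
        i + r + s     ∎)
        (≤-trans (+-mono-≤ c≤m (<⇒≤ r<s)) (≤-reflexive (+-comm m s)))
        (≤-trans s≤r+m (+-monoˡ-≤ m (m≤n+m r c)))
        where open ≡-Reasoning

  module Descending (m : ℕ) {L : ℕ} (1+L≤n : suc L ≤ n) where
    open Chart path n m (suc L ∸_) L

    vertex : ∀ {r} → r ≤ L → InV n (suc L ∸ r)
    vertex {r} r≤L = subst (1 ≤_) (sym (+-∸-assoc 1 r≤L)) (s≤s z≤n) , ≤-trans (m∸n≤m (suc L) r) 1+L≤n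

    complement : ∀ {r} → r ≤ L → suc L ∸ r + r ≡ suc L
    complement r≤L = m∸n+n≡m (m≤n⇒m≤1+n r≤L)

    near : Near
    near r≤L r′≤L r≤r′+m r′≤r+m =
      path-near _ _ (vertex r′≤L) (vertex r≤L) (trans (complement r′≤L) (sym (complement r≤L))) r′≤r+m r≤r′+m

    classify : Classification AheadWithin
    classify {s} {p} s≤L (vp , d , d≤m , walk) with path-walk-bound walk | p ≤? suc L ∸ s
    ... | _ , φs≤ | yes p≤φs with m≤n⇒∃[o]m+o≡n p≤φs
    ...   | c , p+c≡φs = inj₁ (s + c , ≤-pred (subst (suc (s + c) ≤_) p+q≡ (+-monoˡ-≤ (s + c) (proj₁ vp))) ,
                               m≤m+n s c , +-monoʳ-≤ s c≤m , dom)
      where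
      c≤m : c ≤ m
      c≤m = ≤-trans (+-cancelˡ-≤ p c d (subst (_≤ p + d) (sym p+c≡φs) φs≤)) d≤m
      p+q≡ : p + (s + c) ≡ suc L
      p+q≡ = begin
        p + (s + c) ≡⟨ cong (p +_) (+-comm s c) ⟩
        p + (c + s) ≡⟨ sym (+-assoc p c s) ⟩
        p + c + s   ≡⟨ cong (_+ s) p+c≡φs ⟩
        suc L ∸ s + s ≡⟨ complement s≤L ⟩
        suc L       ∎
        where open ≡-Reasoning
      dom : ∀ {r} → r ≤ L → s + c ≤ r + m → r ≤ s + c + m → InN path n m (suc L ∸ r) p
      dom r≤L q≤r+m r≤q+m = path-near _ _ vp (vertex r≤L) (trans p+q≡ (sym (complement r≤L))) q≤r+m r≤q+m
    classify {s} {p} s≤L (vp , d , d≤m , walk) | p≤ , _ | no p≰φs with m≤n⇒∃[o]m+o≡n (<⇒≤ (≰⇒> p≰φs))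
    ...   | c , φs+c≡p = inj₂ dom
      where
      c≤m : c ≤ m
      c≤m = ≤-trans (+-cancelˡ-≤ (suc L ∸ s) c d (subst (_≤ suc L ∸ s + d) (sym φs+c≡p) p≤)) d≤m
      dom : ∀ {r} → r < s → s ≤ r + m → InN path n m (suc L ∸ r) p
      dom {r} r<s s≤r+m = path-near _ _ vp (vertex r≤L) (begin
        p + s                 ≡⟨ cong (_+ s) (sym φs+c≡p) ⟩
        suc L ∸ s + c + s     ≡⟨ +-assoc (suc L ∸ s) c s ⟩
        suc L ∸ s + (c + s)   ≡⟨ cong (suc L ∸ s +_) (+-comm c s) ⟩
        suc L ∸ s + (s + c)   ≡⟨ sym (+-assoc (suc L ∸ s) s c) ⟩
        suc L ∸ s + s + c     ≡⟨ cong (_+ c) (trans (complement s≤L) (sym (complement r≤L))) ⟩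
        suc L ∸ r + r + c     ≡⟨ +-assoc (suc L ∸ r) r c ⟩
        suc L ∸ r + (r + c)   ∎)
        (≤-trans s≤r+m (+-monoˡ-≤ m (m≤m+n r c)))
        (+-mono-≤ (<⇒≤ r<s) c≤m)
        where
        open ≡-Reasoning
        r≤L : r ≤ L
        r≤L = ≤-trans (<⇒≤ r<s) s≤L

interval-position : ∀ {n i t x} → InCIo n i (plusMod n i t) x → Σ ℕ λ s → s < t × x ≡ plusMod n i s
interval-position {t = t} ((s , x≡ , before-end) , x≢end) with s <? t
... | yes s<t = s , s<t , x≡
... | no s≮t with s ≟ t
...   | yes refl = ⊥-elim (x≢end x≡)
...   | no s≢t = ⊥-elim (before-end t (≤∧≢⇒< (≮⇒≥ s≮t) (s≢t ∘′ sym)) refl)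

module _ {m : ℕ} {S : List ℕ} (φ : ℕ → ℕ) (L : ℕ) where

  closed-count : SegmentBound m S φ L → φ L ∈ S → ∀ {xs} → Unique xs →
    All (λ x → x ∈ S × x ≢ φ L × x ∈ applyUpTo φ (suc L)) xs → length xs ≤ L ∸ m
  closed-count bound φL∈S {xs} uxs xs⊆ with bound (all-map (λ (_ , x≢ , _) → x≢ ∘′ sym) xs⊆ ∷ uxs)
                                                  ((φL∈S , ∈-applyUpTo⁺ φ ≤-refl) ∷ all-map (λ (x∈S , _ , x∈seg) → x∈S , x∈seg) xs⊆)
  ... | inj₁ 1+xs+m≤1+L = m+n≤o⇒m≤o∸n (length xs) (≤-pred 1+xs+m≤1+L)
  ... | inj₂ (s≤s xs≤0) = ≤-trans xs≤0 z≤n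

count-bound-sum : ∀ {m L₁ L₂ a c} → m ≤ L₁ + L₂ → CountBound m L₁ a → CountBound m L₂ (suc c) →
  a + c ≤ L₁ + suc L₂ ∸ m
count-bound-sum {m} {L₁} {L₂} {a} {c} m≤L₁+L₂ bound₁ bound₂ = m+n≤o⇒m≤o∸n (a + c) (sum bound₁ bound₂)
  where
  at-most-all : CountBound m L₁ a → a ≤ suc L₁
  at-most-all (inj₁ a+m≤) = ≤-trans (m≤m+n a m) a+m≤
  at-most-all (inj₂ a≤1) = ≤-trans a≤1 (s≤s z≤n)
  sum : CountBound m L₁ a → CountBound m L₂ (suc c) → a + c + m ≤ L₁ + suc L₂
  sum bound₁ (inj₁ (s≤s c+m≤L₂)) = begin
    a + c + m     ≡⟨ +-assoc a c m ⟩
    a + (c + m)   ≤⟨ +-mono-≤ (at-most-all bound₁) c+m≤L₂ ⟩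
    suc L₁ + L₂   ≡⟨ sym (+-suc L₁ L₂) ⟩
    L₁ + suc L₂   ∎
    where open ≤-Reasoning
  sum (inj₁ a+m≤1+L₁) (inj₂ (s≤s z≤n)) = begin
    a + 0 + m     ≡⟨ cong (_+ m) (+-identityʳ a) ⟩
    a + m         ≤⟨ a+m≤1+L₁ ⟩
    suc L₁        ≤⟨ s≤s (m≤m+n L₁ L₂) ⟩
    suc (L₁ + L₂) ≡⟨ sym (+-suc L₁ L₂) ⟩
    L₁ + suc L₂   ∎
    where open ≤-Reasoning
  sum (inj₂ a≤1) (inj₂ (s≤s z≤n)) = begin
    a + 0 + m     ≡⟨ cong (_+ m) (+-identityʳ a) ⟩
    a + m         ≤⟨ +-mono-≤ a≤1 m≤L₁+L₂ ⟩
    suc (L₁ + L₂) ≡⟨ sym (+-suc L₁ L₂) ⟩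
    L₁ + suc L₂   ∎
    where open ≤-Reasoning

InEither : (ℕ → ℕ) → ℕ → (ℕ → ℕ) → ℕ → (ℕ → Set) → ℕ → Set
InEither φ L₁ ψ L₂ P x = (P x × x ∈ applyUpTo φ (suc L₁)) ⊎ (¬ P x × x ∈ applyUpTo ψ (suc L₂))

module _ {m : ℕ} {S : List ℕ} (φ : ℕ → ℕ) (L₁ : ℕ) (ψ : ℕ → ℕ) (L₂ : ℕ)
         {P : ℕ → Set} (P? : Decidable P) where

  split-count : SegmentBound m S φ L₁ → SegmentBound m S ψ L₂ → ψ 0 ∈ S → m ≤ L₁ + L₂ →
    ∀ {xs} → Unique xs → All (λ x → x ∈ S × x ≢ ψ 0 × InEither φ L₁ ψ L₂ P x) xs → length xs ≤ L₁ + suc L₂ ∸ m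
  split-count bound₁ bound₂ ψ0∈S m≤L₁+L₂ {xs} uxs xs⊆ = begin
    length xs                               ≡⟨ length-filter-split P? xs ⟩
    length (filter P? xs) + length (filter ¬P? xs) ≤⟨ count-bound-sum m≤L₁+L₂ count₁ count₂ ⟩
    L₁ + suc L₂ ∸ m                         ∎
    where
    open ≤-Reasoning
    ¬P? : Decidable (λ x → ¬ P x)
    ¬P? x = ¬? (P? x)
    first-part : ∀ {x} → (x ∈ S × x ≢ ψ 0 × InEither φ L₁ ψ L₂ P x) × P x → x ∈ S × x ∈ applyUpTo φ (suc L₁)
    first-part ((x∈S , _ , inj₁ (_ , x∈seg)) , _) = x∈S , x∈seg
    first-part ((_ , _ , inj₂ (¬px , _)) , px) = ⊥-elim (¬px px)
    second-part : ∀ {x} → (x ∈ S × x ≢ ψ 0 × InEither φ L₁ ψ L₂ P x) × ¬ P x → x ∈ S × x ∈ applyUpTo ψ (suc L₂)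
    second-part ((_ , _ , inj₁ (px , _)) , ¬px) = ⊥-elim (¬px px)
    second-part ((x∈S , _ , inj₂ (_ , x∈seg)) , _) = x∈S , x∈seg
    count₁ : CountBound m L₁ (length (filter P? xs))
    count₁ = bound₁ (Unique.filter⁺ P? uxs) (all-map first-part (All.zip (filter⁺ P? xs⊆ , all-filter P? xs)))
    count₂ : CountBound m L₂ (suc (length (filter ¬P? xs)))
    count₂ = bound₂ (filter⁺ ¬P? (all-map (λ (_ , x≢ , _) → x≢ ∘′ sym) xs⊆) ∷ Unique.filter⁺ ¬P? uxs)
                    ((ψ0∈S , ∈-applyUpTo⁺ ψ (s≤s z≤n)) ∷
                     all-map second-part (All.zip (filter⁺ ¬P? xs⊆ , all-filter ¬P? xs)))

module Arc (k m : ℕ) {i t : ℕ} (vi : InV (suc k) i) (m<t : m < t) (t<N : t < suc k) (S : List ℕ) where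
  open Cyclic k
  open Path N

  ArcBound : Set
  ArcBound = ∀ {xs} → Unique xs → All (λ x → x ∈ S × InCIo N i (i ⊕ t) x) xs → length xs ≤ t ∸ m

  cycle-arc : LegalDom cycle N m S → InI cycle N m S i → InI cycle N m S (i ⊕ t) → ArcBound
  cycle-arc legal first final uxs xs⊆ = closed-count (i ⊕_) t bound (I⇒∈ {cycle} final) uxs (all-map on-rotation xs⊆)
    where
    open Rotation m vi t
    bound : SegmentBound m S (i ⊕_) t
    bound = Segment.closed-bound {g = cycle} legal (i ⊕_) t
      (λ r≤t r′≤t → ⊕-injectiveʳ vi (≤-<-trans r≤t t<N) (≤-<-trans r′≤t t<N)) near
      (subst (InI cycle N m S) (sym (⊕-identityʳ vi)) first) final (λ _ → classify)
    on-rotation : ∀ {x} → x ∈ S × InCIo N i (i ⊕ t) x → x ∈ S × x ≢ i ⊕ t × x ∈ applyUpTo (i ⊕_) (suc t)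
    on-rotation (x∈S , x∈arc) with interval-position {N} {i} {t} x∈arc
    ... | s , s<t , refl = x∈S , proj₂ x∈arc , ∈-applyUpTo⁺ (i ⊕_) (m≤n⇒m≤1+n s<t)

  module Within (i+t≤N : i + t ≤ N) where
    open Ascending m (proj₁ vi) i+t≤N

    no-wrap : ∀ {s} → s ≤ t → i ⊕ s ≡ i + s
    no-wrap {s} s≤t = ⊕-no-wrap s (proj₁ vi) (≤-trans (+-monoʳ-≤ i s≤t) i+t≤N)

    path-arc : LegalDom path N m S → InI path N m S i → InI path N m S (i ⊕ t) → ArcBound
    path-arc legal first final uxs xs⊆ = closed-count (i +_) t bound (I⇒∈ {path} final′) uxs (all-map on-chart xs⊆)
      where
      final′ : InI path N m S (i + t)
      final′ = subst (InI path N m S) (no-wrap ≤-refl) final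
      bound : SegmentBound m S (i +_) t
      bound = Segment.closed-bound {g = path} legal (i +_) t (λ _ _ → +-cancelˡ-≡ i _ _) near
        (subst (InI path N m S) (sym (+-identityʳ i)) first) final′
        (λ s≤t dom → map₁ (λ (q , _ , ahead) → q , ahead) (classify s≤t dom))
      on-chart : ∀ {x} → x ∈ S × InCIo N i (i ⊕ t) x → x ∈ S × x ≢ i + t × x ∈ applyUpTo (i +_) (suc t)
      on-chart (x∈S , x∈arc) with interval-position {N} {i} {t} x∈arc
      ... | s , s<t , refl = x∈S , subst (i ⊕ s ≢_) (no-wrap ≤-refl) (proj₂ x∈arc) ,
        subst (_∈ applyUpTo (i +_) (suc t)) (sym (no-wrap (<⇒≤ s<t))) (∈-applyUpTo⁺ (i +_) (m≤n⇒m≤1+n s<t))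

  -- P_n has no edge between n and 1: the arc is cut into the rising run i, …, n and the
  -- falling run i ⊕ t = suc T, …, 1.
  module Wrapping {T : ℕ} (i+t≡ : i + t ≡ N + suc T) where

    K : ℕ
    K = N ∸ i

    i+K≡N : i + K ≡ N
    i+K≡N = m+[n∸m]≡n (proj₂ vi)

    t≡K+1+T : t ≡ K + suc T
    t≡K+1+T = +-cancelˡ-≡ i t (K + suc T) (trans i+t≡ (trans (cong (_+ suc T) (sym i+K≡N)) (+-assoc i K (suc T))))

    beyond : ∀ {u} → u < N → i ⊕ (K + suc u) ≡ suc u
    beyond {u} u<N = trans (⊕-wrap (K + suc u) (proj₁ vi) N<i+s (≤-trans (≤-reflexive i+s≡) (+-monoʳ-≤ N u<N)))
                           (trans (cong (_∸ N) i+s≡) (m+n∸m≡n N (suc u)))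
      where
      i+s≡ : i + (K + suc u) ≡ N + suc u
      i+s≡ = trans (sym (+-assoc i K (suc u))) (cong (_+ suc u) i+K≡N)
      N<i+s : N < i + (K + suc u)
      N<i+s = subst (N <_) (sym i+s≡) (subst (_≤ N + suc u) (+-comm N 1) (+-monoʳ-≤ N (s≤s z≤n)))

    T<N : T < N
    T<N = ≤-<-trans (m≤n+m T K) (≤-<-trans (n≤1+n (K + T)) (subst (_< N) t≡K+1+T′ t<N))
      where
      t≡K+1+T′ : t ≡ suc (K + T)
      t≡K+1+T′ = trans t≡K+1+T (+-suc K T)

    end≡ : i ⊕ t ≡ suc T
    end≡ = trans (cong (i ⊕_) t≡K+1+T) (beyond T<N)

    1+T<i : suc T < i
    1+T<i = +-cancelʳ-< N (suc T) i (subst (_< i + N) (trans i+t≡ (+-comm N (suc T))) (+-monoʳ-< i t<N))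

    position : ∀ {s} → s < t → InEither (i +_) K (suc T ∸_) T (i ≤_) (i ⊕ s)
    position {s} s<t with s ≤? K
    ... | yes s≤K = inj₁ (subst (i ≤_) (sym no-wrap) (m≤m+n i s) ,
                          subst (_∈ applyUpTo (i +_) (suc K)) (sym no-wrap) (∈-applyUpTo⁺ (i +_) (s≤s s≤K)))
      where
      no-wrap : i ⊕ s ≡ i + s
      no-wrap = ⊕-no-wrap s (proj₁ vi) (≤-trans (+-monoʳ-≤ i s≤K) (≤-reflexive i+K≡N))
    ... | no s≰K with m≤n⇒∃[o]m+o≡n (≰⇒> s≰K)
    ...   | u , refl = inj₂ (subst (λ x → ¬ i ≤ x) (sym wrapped) (<⇒≱ (<-trans (s≤s u<T) 1+T<i)) ,
                             subst (_∈ applyUpTo (suc T ∸_) (suc T)) (sym (trans wrapped (sym mirror)))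
                                   (∈-applyUpTo⁺ (suc T ∸_) (s≤s (m∸n≤m T u))))
      where
      u<T : u < T
      u<T = ≤-pred (+-cancelˡ-< K (suc u) (suc T) (subst₂ _<_ (sym (+-suc K u)) t≡K+1+T s<t))
      wrapped : i ⊕ (suc K + u) ≡ suc u
      wrapped = trans (cong (i ⊕_) (sym (+-suc K u))) (beyond (<-trans u<T T<N))
      mirror : suc T ∸ (T ∸ u) ≡ suc u
      mirror = trans (+-∸-assoc 1 (m∸n≤m T u)) (cong suc (m∸[m∸n]≡n (<⇒≤ u<T)))

    path-arc : LegalDom path N m S → InI path N m S i → InI path N m S (i ⊕ t) → ArcBound
    path-arc legal first final {xs} uxs xs⊆ = subst (λ z → length xs ≤ z ∸ m) (sym t≡K+1+T)
      (split-count (i +_) K (suc T ∸_) T (i ≤?_) rising falling (I⇒∈ {path} final′) m≤K+T uxs (all-map on-charts xs⊆))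
      where
      module A = Ascending m (proj₁ vi) (≤-reflexive i+K≡N)
      module B = Descending m (subst (_≤ N) end≡ (proj₂ (⊕-vertex i t)))
      final′ : InI path N m S (suc T)
      final′ = subst (InI path N m S) end≡ final
      rising : SegmentBound m S (i +_) K
      rising = Segment.open-bound {g = path} legal (i +_) K (λ _ _ → +-cancelˡ-≡ i _ _) A.near
        (subst (InI path N m S) (sym (+-identityʳ i)) first)
        (λ s≤K dom → map₁ (λ (q , i+q≤N , ahead) → q , +-cancelˡ-≤ i q K (subst (i + q ≤_) (sym i+K≡N) i+q≤N) , ahead)
                          (A.classify s≤K dom))
      falling : SegmentBound m S (suc T ∸_) T
      falling = Segment.open-bound {g = path} legal (suc T ∸_) T
        (λ r≤T r′≤T → ∸-cancelˡ-≡ (m≤n⇒m≤1+n r≤T) (m≤n⇒m≤1+n r′≤T)) B.near final′ B.classify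
      m≤K+T : m ≤ K + T
      m≤K+T = ≤-pred (subst (m <_) (trans t≡K+1+T (+-suc K T)) m<t)
      on-charts : ∀ {x} → x ∈ S × InCIo N i (i ⊕ t) x →
        x ∈ S × x ≢ suc T × InEither (i +_) K (suc T ∸_) T (i ≤_) x
      on-charts (x∈S , x∈arc) with interval-position {N} {i} {t} x∈arc
      ... | s , s<t , refl = x∈S , subst (i ⊕ s ≢_) end≡ (proj₂ x∈arc) , position s<t

  arc-bound : ∀ g → LegalDom g N m S → InI g N m S i → InI g N m S (i ⊕ t) → ArcBound
  arc-bound cycle = cycle-arc
  arc-bound path with i + t ≤? N
  ... | yes i+t≤N = Within.path-arc i+t≤N
  ... | no i+t≰N with m≤n⇒∃[o]m+o≡n (≰⇒> i+t≰N)
  ...   | T , N+1+T≡i+t = Wrapping.path-arc (trans (sym N+1+T≡i+t) (sym (+-suc N T)))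

full-turn-empty : ∀ {k i x} → InV (suc k) i → ¬ InCIo (suc k) i (plusMod (suc k) i (suc k)) x
full-turn-empty vi ((zero , x≡ , _) , x≢end) = x≢end (trans x≡ (trans (⊕-identityʳ vi) (sym (⊕-period vi))))
  where open Cyclic _
full-turn-empty vi ((suc s , _ , before-end) , _) = before-end 0 (s≤s z≤n) (trans (⊕-identityʳ vi) (sym (⊕-period vi)))
  where open Cyclic _

lemma4 : (g : Kind) (m n : ℕ) → 1 ≤ m → 1 ≤ n →
    (i : ℕ) → InV n i → (t : ℕ) → m + 1 ≤ t → t ≤ n →
    (S : List ℕ) → LegalDom g n m S →
    (∀ x → ((InI g n m S x × InCI n i (plusMod n i t) x) → (x ≡ i ⊎ x ≡ plusMod n i t))
         × ((x ≡ i ⊎ x ≡ plusMod n i t) → (InI g n m S x × InCI n i (plusMod n i t) x))) →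
    CardLe (λ x → x ∈ S × InCIo n i (plusMod n i t) x) (t ∸ m)
lemma4 g m zero _ ()
lemma4 g m (suc k) _ _ i vi t m+1≤t t≤n S legal endpoints with t ≟ suc k
... | yes refl = λ { [] _ _ → z≤n ; (_ ∷ _) _ ((_ , x∈arc) ∷ _) → ⊥-elim (full-turn-empty vi x∈arc) }
... | no t≢n = λ xs → Arc.arc-bound k m vi (subst (_≤ t) (+-comm m 1) m+1≤t) (≤∧≢⇒< t≤n t≢n) S g legal
  (proj₁ (proj₂ (endpoints i) (inj₁ refl))) (proj₁ (proj₂ (endpoints _) (inj₂ refl)))
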